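{- Let $n\ge 3$, let $\overrightarrow{C_n}$ be an oriented cycle and $D$ a nonempty set of finite distances of $\overrightarrow{C_n}$ such that $\overrightarrow{C_n}$ is $D$-antimagic. If $\overrightarrow{C_n}$ is neither unidirectional nor $\Theta$-oriented, then $\min(D)=0$.
   Context: An oriented cycle is an orientation of the cycle on vertices $v_1,\dots,v_n$. It is unidirectional if (for a suitable labeling) its arcs are $(v_i,v_{i+1})$, $1\le i\le n-1$, and $(v_n,v_1)$; it is $\Theta$-oriented if (for a suitable labeling) its arcs are $(v_i,v_{i+1})$, $1\le i\le n-1$, and $(v_1,v_n)$. $d(u,y)$ is the length of a shortest directed path from $u$ to $y$ ($d(u,u)=0$, $\infty$ if none). $N_D(v)=\{y:d(v,y)\in D\}$; a bijection $f:V\to\{1,\dots,n\}$ is $D$-antimagic if $\omega_D(v)=\sum_{y\in N_D(v)}f(y)$ are pairwise distinct; the graph is $D$-antimagic if such a bijection exists. -}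

module Defs where

open import Data.Nat using (ℕ; zero; suc; _+_; _<_)
open import Data.Nat.DivMod using (_mod_)
open import Data.Fin using (Fin; toℕ)
open import Data.List using (List; []; _∷_; allFin)
open import Data.Product using (Σ; ∃; _×_; _,_)
open import Data.Sum using (_⊎_)
open import Relation.Nullary using (¬_)
open import Relation.Binary.PropositionalEquality using (_≡_)
open import Function.Definitions using (Bijective)
open import Function.Bundles using (_⇔_)
open import Data.Bool using (Bool; true; false)

Digraph : ℕ → Set₁
Digraph n = Fin n → Fin n → Set

next : ∀ {n} → Fin n → Fin n
next {zero} ()
next {suc k} i = suc (toℕ i) mod suc k

-- An oriented cycle on Fin n: the underlying cycle has edges {i, i+1 mod n};
-- o i = true  : edge i is oriented i → i+1,
-- o i = false : edge i is oriented i+1 → i.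
OrientedCycle : ∀ {n} → (Fin n → Bool) → Digraph n
OrientedCycle o a b = (b ≡ next a × o a ≡ true) ⊎ (a ≡ next b × o b ≡ false)

-- The arc set of G equals the arc set of the pattern P under the labeling σ
-- (σ i is the vertex labelled v_{i+1}; labels 1..n are Fin indices 0..n-1).
HasLabeling : ∀ {n} → Digraph n → (Fin n → Fin n → Set) → Set
HasLabeling {n} G P =
  Σ (Fin n → Fin n) λ σ → Bijective _≡_ _≡_ σ ×
    (∀ a b → G a b ⇔ (∃ λ i → ∃ λ j → σ i ≡ a × σ j ≡ b × P i j))

UniPattern : ∀ {n} → Fin n → Fin n → Set
UniPattern i j = j ≡ next i

-- Θ pattern: arcs (v_i, v_{i+1}) for 1 ≤ i ≤ n-1 and (v_1, v_n)
ThetaPattern : ∀ {n} → Fin n → Fin n → Set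
ThetaPattern {n} i j =
  (j ≡ next i × suc (toℕ i) < n) ⊎ (toℕ i ≡ 0 × suc (toℕ j) ≡ n)

Unidirectional : ∀ {n} → Digraph n → Set
Unidirectional G = HasLabeling G UniPattern

ThetaOriented : ∀ {n} → Digraph n → Set
ThetaOriented G = HasLabeling G ThetaPattern

data Walk {n} (G : Digraph n) : Fin n → Fin n → ℕ → Set where
  here : ∀ {u} → Walk G u u 0
  step : ∀ {u z y k} → G u z → Walk G z y k → Walk G u y (suc k)

IsDist : ∀ {n} → Digraph n → Fin n → Fin n → ℕ → Set
IsDist G u y k = Walk G u y k × (∀ m → m < k → ¬ Walk G u y m)

InN : ∀ {n} → Digraph n → (ℕ → Set) → Fin n → Fin n → Set
InN G D v y = ∃ λ k → IsDist G v y k × D k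

data SumOver {n} (P : Fin n → Set) (g : Fin n → ℕ) : List (Fin n) → ℕ → Set where
  nil  : SumOver P g [] 0
  take : ∀ {y ys s} → P y → SumOver P g ys s → SumOver P g (y ∷ ys) (g y + s)
  skip : ∀ {y ys s} → ¬ P y → SumOver P g ys s → SumOver P g (y ∷ ys) s

-- D-antimagic: a bijection f : V → {1..n} (encoded as Fin n, value toℕ + 1)
-- such that the weights ω_D(v) = Σ_{y ∈ N_D(v)} f(y) are pairwise distinct.
DAntimagic : ∀ {n} → Digraph n → (ℕ → Set) → Set
DAntimagic {n} G D =
  Σ (Fin n → Fin n) λ f → Bijective _≡_ _≡_ f ×
    Σ (Fin n → ℕ) λ ω →
      (∀ v → SumOver (InN G D v) (λ y → suc (toℕ (f y))) (allFin n) (ω v)) ×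
      (∀ v w → ω v ≡ ω w → v ≡ w)

-- A sink v has no out-arcs, so N_D(v) ⊆ {v}, and v ∈ N_D(v) only if 0 ∈ D. Hence if 0 ∉ D every
-- sink has weight 0 and an antimagic labelling leaves room for at most one sink. An oriented cycle
-- without a sink is unidirectional. With exactly one sink t it is the union of two directed paths
-- from a source to t; if one of them is a single arc the cycle is Θ-oriented. Otherwise the two
-- in-neighbours a, b of t have t as their only out-neighbour, so N_D(a) and N_D(b) can only differ
-- at distance 0, and ω_D(a) ≠ ω_D(b) again forces 0 ∈ D.

module Submission where

open import Defs
open import Data.Nat using (ℕ; _≤_)
open import Data.Bool using (Bool)
open import Data.Fin using (Fin)
open import Data.Product using (∃; _×_)
open import Relation.Nullary using (¬_)

open import Data.Nat using (zero; suc; _+_; _∸_; _<_; _<ᵇ_; z≤n; s≤s; z<s; NonZero)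
open import Data.Nat.Properties
  using (+-identityʳ; +-suc; +-assoc; suc-injective; ≤-pred; <⇒≤; ≤-trans; <-trans; <-irrefl; n<1+n; m<n⇒m<1+n;
         m≤m+n; +-monoʳ-<; m+[n∸m]≡n; m∸n+n≡m; m∸n≤m; +-∸-assoc; ≤-reflexive; n∸n≡0; m<1+n⇒m<n∨m≡n; <ᵇ⇒<; <⇒<ᵇ)
open import Data.Nat.Divisibility using (∣-refl)
open import Data.Nat.DivMod using (_%_; %-distribˡ-+; %-remove-+ˡ; m%n%n≡m%n; [m+n]%n≡m%n; m%n<n; m<n⇒m%n≡m; n%n≡0)
open import Data.Bool using (true; false; not) renaming (_≟_ to _≟ᵇ_)
open import Data.Bool.Properties using (not-involutive; T-≡; ¬-not)
open import Data.Fin using (toℕ; fromℕ; fromℕ<; opposite; _≟_) renaming (zero to fzero)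
open import Data.Fin.Properties using (toℕ-injective; toℕ<n; toℕ-fromℕ; toℕ-fromℕ<; opposite-prop; opposite-involutive; any?)
open import Data.Product using (_,_; proj₁; proj₂)
open import Data.Sum using (_⊎_; inj₁; inj₂)
import Data.Sum as Sum
open import Function.Base using (id; _∘_; flip)
open import Function.Bundles using (_⇔_; mk⇔; Equivalence)
open import Function.Definitions using (Injective; Bijective)
open import Function.Consequences.Propositional using (strictlySurjective⇒surjective)
open import Function.Properties.Equivalence using () renaming (trans to ⇔-trans)
import Function.Construct.Identity as Identity
open import Function.Construct.Composition using () renaming (bijective to ∘-bijective)
open import Relation.Nullary using (yes; no; ¬?; contradiction)
open import Relation.Nullary.Decidable using (_×-dec_; decidable-stable)
open import Relation.Unary using (Decidable)
open import Relation.Binary.PropositionalEquality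

private variable
  n k : ℕ

[m+n%d]%d≡[m+n]%d : ∀ m n d .{{_ : NonZero d}} → (m + n % d) % d ≡ (m + n) % d
[m+n%d]%d≡[m+n]%d m n d = begin
  (m + n % d) % d           ≡⟨ %-distribˡ-+ m (n % d) d ⟩
  (m % d + n % d % d) % d   ≡⟨ cong (λ x → (m % d + x) % d) (m%n%n≡m%n n d) ⟩
  (m % d + n % d) % d       ≡⟨ %-distribˡ-+ m n d ⟨
  (m + n) % d               ∎
  where open ≡-Reasoning

toℕ-next : (i : Fin (suc k)) → toℕ (next i) ≡ suc (toℕ i) % suc k
toℕ-next {k} i = toℕ-fromℕ< (m%n<n (suc (toℕ i)) (suc k))

shift : Fin (suc k) → ℕ → Fin (suc k)
shift c zero    = c
shift c (suc m) = next (shift c m)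

toℕ-shift : (c : Fin (suc k)) (m : ℕ) → toℕ (shift c m) ≡ (toℕ c + m) % suc k
toℕ-shift {k} c zero = begin
  toℕ c                ≡⟨ m<n⇒m%n≡m (toℕ<n c) ⟨
  toℕ c % suc k        ≡⟨ cong (_% suc k) (+-identityʳ (toℕ c)) ⟨
  (toℕ c + 0) % suc k  ∎
  where open ≡-Reasoning
toℕ-shift {k} c (suc m) = begin
  toℕ (next (shift c m))          ≡⟨ toℕ-next (shift c m) ⟩
  suc (toℕ (shift c m)) % suc k   ≡⟨ cong (λ x → suc x % suc k) (toℕ-shift c m) ⟩
  (1 + (toℕ c + m) % suc k) % suc k ≡⟨ [m+n%d]%d≡[m+n]%d 1 (toℕ c + m) (suc k) ⟩
  suc (toℕ c + m) % suc k         ≡⟨ cong (_% suc k) (+-suc (toℕ c) m) ⟨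
  (toℕ c + suc m) % suc k         ∎
  where open ≡-Reasoning

shift-+ : (c : Fin (suc k)) (a b : ℕ) → shift (shift c a) b ≡ shift c (a + b)
shift-+ c a zero    = cong (shift c) (sym (+-identityʳ a))
shift-+ c a (suc b) = trans (cong next (shift-+ c a b)) (cong (shift c) (sym (+-suc a b)))

shift-% : (c : Fin (suc k)) (m : ℕ) → shift c (m % suc k) ≡ shift c m
shift-% {k} c m = toℕ-injective (begin
  toℕ (shift c (m % suc k))      ≡⟨ toℕ-shift c (m % suc k) ⟩
  (toℕ c + m % suc k) % suc k    ≡⟨ [m+n%d]%d≡[m+n]%d (toℕ c) m (suc k) ⟩
  (toℕ c + m) % suc k            ≡⟨ toℕ-shift c m ⟨
  toℕ (shift c m)                ∎)
  where open ≡-Reasoning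

shift-period : (c : Fin (suc k)) → shift c (suc k) ≡ c
shift-period {k} c = toℕ-injective (begin
  toℕ (shift c (suc k))        ≡⟨ toℕ-shift c (suc k) ⟩
  (toℕ c + suc k) % suc k      ≡⟨ [m+n]%n≡m%n (toℕ c) (suc k) ⟩
  toℕ c % suc k                ≡⟨ m<n⇒m%n≡m (toℕ<n c) ⟩
  toℕ c                        ∎)
  where open ≡-Reasoning

offset : Fin (suc k) → Fin (suc k) → ℕ
offset {k} c v = (suc k ∸ toℕ c + toℕ v) % suc k

shift-offset : (c v : Fin (suc k)) → shift c (offset c v) ≡ v
shift-offset {k} c v = toℕ-injective (begin
  toℕ (shift c (offset c v))                         ≡⟨ toℕ-shift c (offset c v) ⟩
  (toℕ c + (suc k ∸ toℕ c + toℕ v) % suc k) % suc k  ≡⟨ [m+n%d]%d≡[m+n]%d (toℕ c) (suc k ∸ toℕ c + toℕ v) (suc k) ⟩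
  (toℕ c + (suc k ∸ toℕ c + toℕ v)) % suc k          ≡⟨ cong (_% suc k) (+-assoc (toℕ c) _ (toℕ v)) ⟨
  (toℕ c + (suc k ∸ toℕ c) + toℕ v) % suc k          ≡⟨ cong (λ x → (x + toℕ v) % suc k) (m+[n∸m]≡n (<⇒≤ (toℕ<n c))) ⟩
  (suc k + toℕ v) % suc k                            ≡⟨ %-remove-+ˡ (toℕ v) ∣-refl ⟩
  toℕ v % suc k                                      ≡⟨ m<n⇒m%n≡m (toℕ<n v) ⟩
  toℕ v                                              ∎)
  where open ≡-Reasoning

offset-shift : (c : Fin (suc k)) {m : ℕ} → m < suc k → offset c (shift c m) ≡ m
offset-shift {k} c {m} m<n = begin
  (suc k ∸ toℕ c + toℕ (shift c m)) % suc k      ≡⟨ cong (λ x → (suc k ∸ toℕ c + x) % suc k) (toℕ-shift c m) ⟩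
  (suc k ∸ toℕ c + (toℕ c + m) % suc k) % suc k  ≡⟨ [m+n%d]%d≡[m+n]%d (suc k ∸ toℕ c) (toℕ c + m) (suc k) ⟩
  (suc k ∸ toℕ c + (toℕ c + m)) % suc k          ≡⟨ cong (_% suc k) (+-assoc (suc k ∸ toℕ c) (toℕ c) m) ⟨
  (suc k ∸ toℕ c + toℕ c + m) % suc k            ≡⟨ cong (λ x → (x + m) % suc k) (m∸n+n≡m (<⇒≤ (toℕ<n c))) ⟩
  (suc k + m) % suc k                            ≡⟨ %-remove-+ˡ m ∣-refl ⟩
  m % suc k                                      ≡⟨ m<n⇒m%n≡m m<n ⟩
  m                                              ∎
  where open ≡-Reasoning

shift-injective : (c : Fin (suc k)) {m m′ : ℕ} → m < suc k → m′ < suc k → shift c m ≡ shift c m′ → m ≡ m′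
shift-injective c {m} {m′} m<n m′<n eq =
  trans (sym (offset-shift c m<n)) (trans (cong (offset c) eq) (offset-shift c m′<n))

shift-surjective : (c v : Fin (suc k)) → ∃ λ m → m < suc k × shift c m ≡ v
shift-surjective {k} c v = offset c v , m%n<n (suc k ∸ toℕ c + toℕ v) (suc k) , shift-offset c v

shift-≢ : (c : Fin (suc k)) {m : ℕ} → 0 < m → m < suc k → shift c m ≢ c
shift-≢ c 0<m m<n eq with shift-injective c m<n z<s eq
shift-≢ c () m<n eq | refl

prev : Fin (suc k) → Fin (suc k)
prev {k} v = shift v k

prev-next : (v : Fin (suc k)) → prev (next v) ≡ v
prev-next {k} v = trans (shift-+ v 1 k) (shift-period v)

next-injective : {u v : Fin (suc k)} → next u ≡ next v → u ≡ v
next-injective {u = u} {v} eq = trans (sym (prev-next u)) (trans (cong prev eq) (prev-next v))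

rotate : Fin (suc k) → Fin (suc k) → Fin (suc k)
rotate c x = shift c (toℕ x)

rotate-injective : (c : Fin (suc k)) → Injective _≡_ _≡_ (rotate c)
rotate-injective c eq = toℕ-injective (shift-injective c (toℕ<n _) (toℕ<n _) eq)

rotate-bijective : (c : Fin (suc k)) → Bijective _≡_ _≡_ (rotate c)
rotate-bijective c = rotate-injective c , strictlySurjective⇒surjective surjective
  where
  surjective : ∀ v → ∃ λ x → rotate c x ≡ v
  surjective v with shift-surjective c v
  ... | m , m<n , eq = fromℕ< m<n , trans (cong (shift c) (toℕ-fromℕ< m<n)) eq

rotate-next : (c x : Fin (suc k)) → rotate c (next x) ≡ next (rotate c x)
rotate-next {k} c x = trans (cong (shift c) (toℕ-next x)) (shift-% c (suc (toℕ x)))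

rotate-fromℕ : (c : Fin (suc k)) → rotate c (fromℕ k) ≡ prev c
rotate-fromℕ {k} c = cong (shift c) (toℕ-fromℕ k)

fromℕ⊎suc< : (i : Fin (suc k)) → i ≡ fromℕ k ⊎ suc (toℕ i) < suc k
fromℕ⊎suc< {k} i with m<1+n⇒m<n∨m≡n (toℕ<n i)
... | inj₁ i<k = inj₂ (s≤s i<k)
... | inj₂ i≡k = inj₁ (toℕ-injective (trans i≡k (sym (toℕ-fromℕ k))))

next-fromℕ : next (fromℕ k) ≡ fzero
next-fromℕ {k} = toℕ-injective (begin
  toℕ (next (fromℕ k))           ≡⟨ toℕ-next (fromℕ k) ⟩
  suc (toℕ (fromℕ k)) % suc k    ≡⟨ cong (λ x → suc x % suc k) (toℕ-fromℕ k) ⟩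
  suc k % suc k                  ≡⟨ n%n≡0 (suc k) ⟩
  0                              ∎)
  where open ≡-Reasoning

toℕ-next-< : (i : Fin (suc k)) → suc (toℕ i) < suc k → toℕ (next i) ≡ suc (toℕ i)
toℕ-next-< i lt = trans (toℕ-next i) (m<n⇒m%n≡m lt)

opposite-injective : Injective _≡_ _≡_ (opposite {suc k})
opposite-injective {x = x} {y} eq = trans (sym (opposite-involutive x)) (trans (cong opposite eq) (opposite-involutive y))

opposite-bijective : Bijective _≡_ _≡_ (opposite {suc k})
opposite-bijective = opposite-injective , strictlySurjective⇒surjective λ y → opposite y , opposite-involutive y

opposite-fromℕ : opposite (fromℕ k) ≡ fzero
opposite-fromℕ {k} = toℕ-injective
  (trans (opposite-prop (fromℕ k)) (trans (cong (k ∸_) (toℕ-fromℕ k)) (n∸n≡0 k)))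

next-opposite-next : (i : Fin (suc k)) → next (opposite (next i)) ≡ opposite i
next-opposite-next {k} i with fromℕ⊎suc< i
... | inj₁ refl = begin
  next (opposite (next (fromℕ k)))  ≡⟨ cong (next ∘ opposite) next-fromℕ ⟩
  next (fromℕ k)                    ≡⟨ next-fromℕ ⟩
  fzero                             ≡⟨ opposite-fromℕ ⟨
  opposite (fromℕ k)                ∎
  where open ≡-Reasoning
... | inj₂ lt = toℕ-injective (begin
  toℕ (next (opposite (next i)))          ≡⟨ toℕ-next (opposite (next i)) ⟩
  suc (toℕ (opposite (next i))) % suc k   ≡⟨ cong (λ x → suc x % suc k) (opposite-prop (next i)) ⟩
  suc (k ∸ toℕ (next i)) % suc k          ≡⟨ cong (λ x → suc (k ∸ x) % suc k) (toℕ-next-< i lt) ⟩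
  suc (k ∸ suc (toℕ i)) % suc k           ≡⟨ cong (_% suc k) (+-∸-assoc 1 (≤-pred lt)) ⟨
  (k ∸ toℕ i) % suc k                     ≡⟨ m<n⇒m%n≡m (s≤s (m∸n≤m k (toℕ i))) ⟩
  k ∸ toℕ i                               ≡⟨ opposite-prop i ⟨
  toℕ (opposite i)                        ∎)
  where open ≡-Reasoning

labeling : {G : Digraph n} {P : Fin n → Fin n → Set} (σ : Fin n → Fin n) → Bijective _≡_ _≡_ σ
         → (∀ i j → G (σ i) (σ j) ⇔ P i j) → HasLabeling G P
labeling {G = G} {P} σ σ-bij@(_ , σ-surj) arcs = σ , σ-bij , λ a b → mk⇔ (to a b) from
  where
  to : ∀ a b → G a b → ∃ λ i → ∃ λ j → σ i ≡ a × σ j ≡ b × P i j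
  to a b g with σ-surj a | σ-surj b
  ... | i , σi≡a | j , σj≡b with σi≡a refl | σj≡b refl
  ... | refl | refl = i , j , refl , refl , Equivalence.to (arcs i j) g
  from : ∀ {a b} → (∃ λ i → ∃ λ j → σ i ≡ a × σ j ≡ b × P i j) → G a b
  from (i , j , refl , refl , p) = Equivalence.from (arcs i j) p

module _ {o o′ : Fin (suc k) → Bool} {σ : Fin (suc k) → Fin (suc k)} (σ-injective : Injective _≡_ _≡_ σ) where

  rotation⇔ : (∀ i → σ (next i) ≡ next (σ i)) → (∀ i → o (σ i) ≡ o′ i)
            → ∀ i j → OrientedCycle o (σ i) (σ j) ⇔ OrientedCycle o′ i j
  rotation⇔ σ-next σ-o i j = mk⇔ to from
    where
    to : OrientedCycle o (σ i) (σ j) → OrientedCycle o′ i j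
    to (inj₁ (eq , oi)) = inj₁ (σ-injective (trans eq (sym (σ-next i))) , trans (sym (σ-o i)) oi)
    to (inj₂ (eq , oj)) = inj₂ (σ-injective (trans eq (sym (σ-next j))) , trans (sym (σ-o j)) oj)
    from : OrientedCycle o′ i j → OrientedCycle o (σ i) (σ j)
    from (inj₁ (refl , oi)) = inj₁ (σ-next i , trans (σ-o i) oi)
    from (inj₂ (refl , oj)) = inj₂ (σ-next j , trans (σ-o j) oj)

  reflection⇔ : (∀ i → next (σ (next i)) ≡ σ i) → (∀ i → not (o (σ (next i))) ≡ o′ i)
              → ∀ i j → OrientedCycle o (σ i) (σ j) ⇔ OrientedCycle o′ i j
  reflection⇔ σ-next σ-o i j = mk⇔ to from
    where
    step-back : ∀ {u v} → σ v ≡ next (σ u) → u ≡ next v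
    step-back {v = v} eq = σ-injective (next-injective (trans (sym eq) (sym (σ-next v))))
    to-o′ : ∀ {u b} → o (σ (next u)) ≡ b → o′ u ≡ not b
    to-o′ {u} eq = trans (sym (σ-o u)) (cong not eq)
    from-o′ : ∀ {u b} → o′ u ≡ b → o (σ (next u)) ≡ not b
    from-o′ {u} eq = trans (sym (not-involutive _)) (cong not (trans (σ-o u) eq))
    to : OrientedCycle o (σ i) (σ j) → OrientedCycle o′ i j
    to (inj₁ (eq , oi)) with refl ← step-back eq = inj₂ (refl , to-o′ oi)
    to (inj₂ (eq , oj)) with refl ← step-back eq = inj₁ (refl , to-o′ oj)
    from : OrientedCycle o′ i j → OrientedCycle o (σ i) (σ j)
    from (inj₁ (refl , oi)) = inj₂ (sym (σ-next i) , from-o′ oi)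
    from (inj₂ (refl , oj)) = inj₁ (sym (σ-next j) , from-o′ oj)

forward : Fin n → Bool
forward _ = true

forward⇔uniPattern : (i j : Fin n) → OrientedCycle forward i j ⇔ UniPattern i j
forward⇔uniPattern i j = mk⇔ to (λ eq → inj₁ (eq , refl))
  where
  to : OrientedCycle forward i j → UniPattern i j
  to (inj₁ (eq , _)) = eq

-- The Θ pattern as an orientation: every edge {i, i+1} points forwards except the closing edge {n-1, 0}.
θ-orientation : Fin n → Bool
θ-orientation {n} i = suc (toℕ i) <ᵇ n

θ-orientation≡true⇔ : {i : Fin n} → θ-orientation i ≡ true ⇔ suc (toℕ i) < n
θ-orientation≡true⇔ {n} {i} = mk⇔ (<ᵇ⇒< (suc (toℕ i)) n ∘ Equivalence.from T-≡) (Equivalence.to T-≡ ∘ <⇒<ᵇ)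

θ-orientation-fromℕ : θ-orientation (fromℕ k) ≡ false
θ-orientation-fromℕ {k} = ¬-not (<-irrefl (cong suc (toℕ-fromℕ k)) ∘ Equivalence.to θ-orientation≡true⇔)

≡θ-orientation : (p : Fin (suc k) → Bool) → p (fromℕ k) ≡ false → (∀ i → i ≢ fromℕ k → p i ≡ true)
               → ∀ i → p i ≡ θ-orientation i
≡θ-orientation {k} p p-last p-rest i with fromℕ⊎suc< i
... | inj₁ refl = trans p-last (sym (θ-orientation-fromℕ {k}))
... | inj₂ lt   = trans (p-rest i i≢last) (sym (Equivalence.from θ-orientation≡true⇔ lt))
  where
  i≢last : i ≢ fromℕ k
  i≢last refl = <-irrefl (cong suc (toℕ-fromℕ k)) lt

θ-orientation⇔thetaPattern : (i j : Fin (suc k)) → OrientedCycle θ-orientation i j ⇔ ThetaPattern i j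
θ-orientation⇔thetaPattern {k} i j = mk⇔ to from
  where
  to : OrientedCycle θ-orientation i j → ThetaPattern i j
  to (inj₁ (eq , θi)) = inj₁ (eq , Equivalence.to θ-orientation≡true⇔ θi)
  to (inj₂ (eq , θj)) with fromℕ⊎suc< j
  ... | inj₁ refl = inj₂ (cong toℕ (trans eq next-fromℕ) , cong suc (toℕ-fromℕ k))
  ... | inj₂ lt   = contradiction (trans (sym θj) (Equivalence.from θ-orientation≡true⇔ lt)) λ ()
  from : ThetaPattern i j → OrientedCycle θ-orientation i j
  from (inj₁ (eq , lt)) = inj₁ (eq , Equivalence.from θ-orientation≡true⇔ lt)
  from (inj₂ (i≡0 , j≡n)) with toℕ-injective {i = i} {j = fzero} i≡0
                             | toℕ-injective {i = j} {j = fromℕ k} (trans (suc-injective j≡n) (sym (toℕ-fromℕ k)))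
  ... | refl | refl = inj₂ (sym next-fromℕ , θ-orientation-fromℕ {k})

module _ {o : Fin (suc k) → Bool} where

  allTrue⇒unidirectional : (∀ v → o v ≡ true) → Unidirectional (OrientedCycle o)
  allTrue⇒unidirectional o≡true = labeling id (Identity.bijective _≡_) λ i j →
    ⇔-trans (rotation⇔ {o = o} id (λ _ → refl) o≡true i j) (forward⇔uniPattern i j)

  allFalse⇒unidirectional : (∀ v → o v ≡ false) → Unidirectional (OrientedCycle o)
  allFalse⇒unidirectional o≡false = labeling opposite opposite-bijective λ i j →
    ⇔-trans (reflection⇔ {o = o} opposite-injective next-opposite-next (λ _ → cong not (o≡false _)) i j)
            (forward⇔uniPattern i j)

  oneFalse⇒θ : ∀ e → o e ≡ false → (∀ v → v ≢ e → o v ≡ true) → ThetaOriented (OrientedCycle o)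
  oneFalse⇒θ e oe o-rest = labeling σ (rotate-bijective (next e)) λ i j →
    ⇔-trans (rotation⇔ {o = o} (rotate-injective (next e)) (rotate-next (next e))
                       (≡θ-orientation (o ∘ σ) o-last o-σ-rest) i j)
            (θ-orientation⇔thetaPattern i j)
    where
    σ = rotate (next e)
    σ-last : σ (fromℕ k) ≡ e
    σ-last = trans (rotate-fromℕ (next e)) (prev-next e)
    o-last : o (σ (fromℕ k)) ≡ false
    o-last = trans (cong o σ-last) oe
    o-σ-rest : ∀ i → i ≢ fromℕ k → o (σ i) ≡ true
    o-σ-rest i i≢last = o-rest (σ i) λ σi≡e → i≢last (rotate-injective (next e) (trans σi≡e (sym σ-last)))

  oneTrue⇒θ : ∀ e → o e ≡ true → (∀ v → v ≢ e → o v ≡ false) → ThetaOriented (OrientedCycle o)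
  oneTrue⇒θ e oe o-rest = labeling σ (∘-bijective _≡_ _≡_ _≡_ opposite-bijective (rotate-bijective c)) λ i j →
    ⇔-trans (reflection⇔ {o = o} σ-injective σ-next
                         (≡θ-orientation (λ i → not (o (σ (next i)))) o-last o-σ-rest) i j)
            (θ-orientation⇔thetaPattern i j)
    where
    c = next e
    σ = rotate c ∘ opposite
    σ-injective : Injective _≡_ _≡_ σ
    σ-injective = opposite-injective ∘ rotate-injective c
    σ-next : ∀ i → next (σ (next i)) ≡ σ i
    σ-next i = trans (sym (rotate-next c _)) (cong (rotate c) (next-opposite-next i))
    σ-first : σ fzero ≡ e
    σ-first = trans (rotate-fromℕ c) (prev-next e)
    o-last : not (o (σ (next (fromℕ k)))) ≡ false
    o-last = cong not (trans (cong (o ∘ σ) next-fromℕ) (trans (cong o σ-first) oe))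
    o-σ-rest : ∀ i → i ≢ fromℕ k → not (o (σ (next i))) ≡ true
    o-σ-rest i i≢last = cong not (o-rest _ λ eq → i≢last (next-injective
      (trans (σ-injective (trans eq (sym σ-first))) (sym next-fromℕ))))

Sink : Digraph n → Fin n → Set
Sink G v = ∀ w → ¬ G v w

OnlyArcTo : Digraph n → Fin n → Fin n → Set
OnlyArcTo G v t = G v t × (∀ w → G v w → w ≡ t)

module _ {P Q : Fin n → Set} {R : Set} {g : Fin n → ℕ} (P⇒Q : ∀ y → P y → R ⊎ Q y) (Q⇒P : ∀ y → Q y → R ⊎ P y) where

  SumOver-cong⊎ : ∀ {ys s s′} → SumOver P g ys s → SumOver Q g ys s′ → R ⊎ s ≡ s′
  SumOver-cong⊎ nil            nil             = inj₂ refl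
  SumOver-cong⊎ (take {y} _ r) (take _ r′)     = Sum.map₂ (cong (g y +_)) (SumOver-cong⊎ r r′)
  SumOver-cong⊎ (skip _ r)     (skip _ r′)     = SumOver-cong⊎ r r′
  SumOver-cong⊎ (take py _)    (skip ¬qy _)    = Sum.map₂ (flip contradiction ¬qy) (P⇒Q _ py)
  SumOver-cong⊎ (skip ¬py _)   (take qy _)     = Sum.map₂ (flip contradiction ¬py) (Q⇒P _ qy)

module _ {G : Digraph n} (D : ℕ → Set) where

  walk-from-sink : ∀ {v y m} → Sink G v → Walk G v y m → y ≡ v × m ≡ 0
  walk-from-sink sink here         = refl , refl
  walk-from-sink sink (step arc _) = contradiction arc (sink _)

  walk-into-sink : ∀ {v t y m} → Sink G t → OnlyArcTo G v t → Walk G v y m → (y ≡ v × m ≡ 0) ⊎ (y ≡ t × m ≡ 1)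
  walk-into-sink _    _          here            = inj₁ (refl , refl)
  walk-into-sink sink (_ , only) (step arc walk) with only _ arc
  ... | refl with walk-from-sink sink walk
  ... | refl , refl = inj₂ (refl , refl)

  InN-sink⇒D0 : ∀ {v y} → Sink G v → InN G D v y → D 0
  InN-sink⇒D0 sink (m , (walk , _) , Dm) with walk-from-sink sink walk
  ... | _ , refl = Dm

  InN-into-sink : ∀ {v t y} → Sink G t → OnlyArcTo G v t → InN G D v y → D 0 ⊎ (y ≡ t × D 1)
  InN-into-sink sink v→t (m , (walk , _) , Dm) with walk-into-sink sink v→t walk
  ... | inj₁ (_ , refl)    = inj₁ Dm
  ... | inj₂ (refl , refl) = inj₂ (refl , Dm)

  InN-arc : ∀ {v t} → G v t → v ≢ t → D 1 → InN G D v t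
  InN-arc arc v≢t D1 = 1 , (step arc here , shorter) , D1
    where
    shorter : ∀ m → m < 1 → ¬ Walk G _ _ m
    shorter zero    _         here = v≢t refl
    shorter (suc _) (s≤s ()) _

  InN-transfer : ∀ {u v t y} → Sink G t → OnlyArcTo G u t → OnlyArcTo G v t → InN G D u y → D 0 ⊎ InN G D v y
  InN-transfer sink u→t (v→t , _) y∈Nu with InN-into-sink sink u→t y∈Nu
  ... | inj₁ D0          = inj₁ D0
  ... | inj₂ (refl , D1) = inj₂ (InN-arc v→t (λ { refl → sink _ v→t }) D1)

  antimagic-separates : ∀ {u v} → DAntimagic G D → u ≢ v
    → (∀ y → InN G D u y → D 0 ⊎ InN G D v y) → (∀ y → InN G D v y → D 0 ⊎ InN G D u y) → D 0
  antimagic-separates {u} {v} (_ , _ , ω , weight , ω-injective) u≢v u⇒v v⇒u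
    with SumOver-cong⊎ u⇒v v⇒u (weight u) (weight v)
  ... | inj₁ D0     = D0
  ... | inj₂ ωu≡ωv = contradiction (ω-injective u v ωu≡ωv) u≢v

  twoSinks⇒D0 : ∀ {u v} → DAntimagic G D → Sink G u → Sink G v → u ≢ v → D 0
  twoSinks⇒D0 antimagic sink-u sink-v u≢v = antimagic-separates antimagic u≢v
    (λ _ → inj₁ ∘ InN-sink⇒D0 sink-u) (λ _ → inj₁ ∘ InN-sink⇒D0 sink-v)

  twinPredecessors⇒D0 : ∀ {a b t} → DAntimagic G D → Sink G t → OnlyArcTo G a t → OnlyArcTo G b t → a ≢ b → D 0
  twinPredecessors⇒D0 antimagic sink a→t b→t a≢b = antimagic-separates antimagic a≢b
    (λ _ → InN-transfer sink a→t b→t) (λ _ → InN-transfer sink b→t a→t)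

SinkAfter : (Fin n → Bool) → Fin n → Set
SinkAfter o i = o i ≡ true × o (next i) ≡ false

module _ {o : Fin (suc k) → Bool} where

  sinkAfter⇒sink : ∀ {i} → SinkAfter o i → Sink (OrientedCycle o) (next i)
  sinkAfter⇒sink (_ , oi+1) _ (inj₁ (_ , oi+1′)) = contradiction (trans (sym oi+1′) oi+1) λ ()
  sinkAfter⇒sink (oi , _) _ (inj₂ (eq , ow)) with next-injective eq
  ... | refl = contradiction (trans (sym oi) ow) λ ()

  onlyArcTo-next : ∀ {a} → o (prev a) ≡ true → o a ≡ true → OnlyArcTo (OrientedCycle o) a (next a)
  onlyArcTo-next {a} o-prev oa = inj₁ (refl , oa) , only
    where
    only : ∀ w → OrientedCycle o a w → w ≡ next a
    only w (inj₁ (eq , _)) = eq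
    only w (inj₂ (eq , ow)) with trans (sym (prev-next w)) (cong prev (sym eq))
    ... | refl = contradiction (trans (sym o-prev) ow) λ ()

  onlyArcTo-prev : ∀ {t} → o t ≡ false → o (next t) ≡ false → OnlyArcTo (OrientedCycle o) (next t) t
  onlyArcTo-prev {t} ot ot+1 = inj₂ (refl , ot) , only
    where
    only : ∀ w → OrientedCycle o (next t) w → w ≡ t
    only w (inj₁ (_ , ot+1′)) = contradiction (trans (sym ot+1′) ot+1) λ ()
    only w (inj₂ (eq , _))   = sym (next-injective eq)

data Shape (o : Fin (suc k) → Bool) : Set where
  allTrue          : (∀ v → o v ≡ true) → Shape o
  allFalse         : (∀ v → o v ≡ false) → Shape o
  oneTrue          : ∀ e → o e ≡ true → (∀ v → v ≢ e → o v ≡ false) → Shape o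
  oneFalse         : ∀ e → o e ≡ false → (∀ v → v ≢ e → o v ≡ true) → Shape o
  twoSinks         : ∀ i w → SinkAfter o i → SinkAfter o w → w ≢ i → Shape o
  -- prev i → i → next i ← next² i ← next³ i
  twinPredecessors : ∀ i → o (prev i) ≡ true → SinkAfter o i → o (next (next i)) ≡ false → Shape o

module _ (o : Fin (suc k) → Bool) where

  sinkAfter? : Decidable (SinkAfter o)
  sinkAfter? i = (o i ≟ᵇ true) ×-dec (o (next i) ≟ᵇ false)

  true-spreads : ∀ c m → o c ≡ true → (∀ j → j < m → ¬ SinkAfter o (shift c j)) → o (shift c m) ≡ true
  true-spreads c zero    oc _       = oc
  true-spreads c (suc m) oc no-sink with o (shift c (suc m)) in oc+m+1
  ... | true  = refl
  ... | false = contradiction (true-spreads c m oc (λ j j<m → no-sink j (m<n⇒m<1+n j<m)) , oc+m+1) (no-sink m (n<1+n m))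

  noSink⇒trueEverywhere : (∀ i → ¬ SinkAfter o i) → ∀ {c} → o c ≡ true → ∀ v → o v ≡ true
  noSink⇒trueEverywhere no-sink {c} oc v with shift-surjective c v
  ... | m , _ , refl = true-spreads c m oc (λ j _ → no-sink (shift c j))

  noSink⇒constant : (∀ i → ¬ SinkAfter o i) → Shape o
  noSink⇒constant no-sink with o fzero in o0
  ... | true  = allTrue (noSink⇒trueEverywhere no-sink o0)
  ... | false = allFalse nowhere
    where
    nowhere : ∀ v → o v ≡ false
    nowhere v with o v in ov
    ... | false = refl
    ... | true  = contradiction (trans (sym (noSink⇒trueEverywhere no-sink ov fzero)) o0) λ ()

  module _ (i : Fin (suc k)) (sink : SinkAfter o i) (unique : ∀ w → SinkAfter o w → w ≡ i) where

    true-spreads-from : ∀ s m → 0 < s → s + m < suc k → o (shift i s) ≡ true → o (shift i (s + m)) ≡ true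
    true-spreads-from s m 0<s s+m<n os =
      subst (λ v → o v ≡ true) (shift-+ i s m) (true-spreads (shift i s) m os no-sink)
      where
      no-sink : ∀ j → j < m → ¬ SinkAfter o (shift (shift i s) j)
      no-sink j j<m sj = shift-≢ i (≤-trans 0<s (m≤m+n s j)) (<-trans (+-monoʳ-< s j<m) s+m<n)
        (trans (sym (shift-+ i s j)) (unique _ sj))

    true-reaches-prev : ∀ s → 0 < s → s < suc k → o (shift i s) ≡ true → o (prev i) ≡ true
    true-reaches-prev s 0<s s<n os = subst (λ m → o (shift i m) ≡ true) s+[k∸s]≡k
      (true-spreads-from s (k ∸ s) 0<s (s≤s (≤-reflexive s+[k∸s]≡k)) os)
      where
      s+[k∸s]≡k : s + (k ∸ s) ≡ k
      s+[k∸s]≡k = m+[n∸m]≡n (≤-pred s<n)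

    uniqueSink⇒shape : Shape o
    uniqueSink⇒shape with o (prev i) in o-prev | o (next (next i)) in o-i+2
    ... | false | _     = oneTrue i (proj₁ sink) falseElsewhere
      where
      falseElsewhere : ∀ v → v ≢ i → o v ≡ false
      falseElsewhere v v≢i with shift-surjective i v
      ... | zero  , _   , refl = contradiction refl v≢i
      ... | suc m , m<n , refl with o (shift i (suc m)) in ov
      ...   | false = refl
      ...   | true  = contradiction (trans (sym o-prev) (true-reaches-prev (suc m) z<s m<n ov)) λ ()
    ... | true  | true  = oneFalse (next i) (proj₂ sink) trueElsewhere
      where
      trueElsewhere : ∀ v → v ≢ next i → o v ≡ true
      trueElsewhere v v≢i+1 with shift-surjective i v
      ... | zero        , _   , refl = proj₁ sink
      ... | suc zero    , _   , refl = contradiction refl v≢i+1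
      ... | suc (suc m) , m<n , refl = true-spreads-from 2 m z<s m<n o-i+2
    ... | true  | false = twinPredecessors i o-prev sink o-i+2

shape : (o : Fin (suc k) → Bool) → Shape o
shape o with any? (sinkAfter? o)
... | no none = noSink⇒constant o λ i si → none (i , si)
... | yes (i , si) with any? (λ w → sinkAfter? o w ×-dec ¬? (w ≟ i))
...   | yes (w , sw , w≢i) = twoSinks i w si sw w≢i
...   | no no-other = uniqueSink⇒shape o i si λ w sw → decidable-stable (w ≟ i) λ w≢i → no-other (w , sw , w≢i)

mainTheorem12 : (n : ℕ) → 3 ≤ n → (o : Fin n → Bool) → (D : ℕ → Set)
    → (∃ λ k → D k)
    → (∀ k → D k → ∃ λ u → ∃ λ y → IsDist (OrientedCycle o) u y k)
    → DAntimagic (OrientedCycle o) D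
    → ¬ Unidirectional (OrientedCycle o)
    → ¬ ThetaOriented (OrientedCycle o)
    → D 0
mainTheorem12 _ (s≤s (s≤s (s≤s z≤n))) o D _ _ antimagic ¬unidirectional ¬θ with shape o
... | allTrue o≡true     = contradiction (allTrue⇒unidirectional o≡true) ¬unidirectional
... | allFalse o≡false   = contradiction (allFalse⇒unidirectional o≡false) ¬unidirectional
... | oneTrue e oe rest  = contradiction (oneTrue⇒θ e oe rest) ¬θ
... | oneFalse e oe rest = contradiction (oneFalse⇒θ e oe rest) ¬θ
... | twoSinks i w si sw w≢i =
  twoSinks⇒D0 D antimagic (sinkAfter⇒sink si) (sinkAfter⇒sink sw) (w≢i ∘ sym ∘ next-injective)
... | twinPredecessors i o-prev (oi , oi+1) oi+2 =
  twinPredecessors⇒D0 D antimagic (sinkAfter⇒sink (oi , oi+1)) (onlyArcTo-next o-prev oi) (onlyArcTo-prev oi+1 oi+2)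
    (shift-≢ i z<s (s≤s (s≤s (s≤s z≤n))) ∘ sym)
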